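{- Let $L_1,L_2$ be two finite co-Heyting algebras having a common subalgebra $L_0$, such that for $i=1,2$, $L_i$ is generated over $L_0$ by a tuple $(x_{i,1},x_{i,2})$ primitive over $L_0$. If these two tuples have the same signature in $L_0$, then there is an isomorphism of co-Heyting algebras from $L_1$ onto $L_2$ which fixes $L_0$ pointwise.
   Context: A co-Heyting algebra is a bounded distributive lattice $(L,\mathbf{0},\mathbf{1},\vee,\wedge)$ with a binary operation $-$ such that $a-b$ is the least $c\in L$ with $a\le b\vee c$; subalgebras are in the language $\{\mathbf 0,\mathbf 1,\vee,\wedge,-\}$. Write $b\ll a$ iff $a-b=a$ and $b\le a$. An element $a$ is join irreducible if it is not the join of any finite subset not containing $a$; $\mathcal J(L)$ denotes the set of join irreducible elements. For $L_0$ a finite subalgebra of $L$: for $a\in L_0$, $a^-=\bigvee\{b\in L_0:b<a\}$; for $x\in L$, $g(x,L_0)=\bigwedge\{a\in L_0:x\le a\}$. A tuple $(x_1,x_2)\in L^2$ is primitive over $L_0$ if $x_1,x_2\notin L_0$ and there is $g\in\mathcal J(L_0)$ such that $g^-\wedge x_1,\ g^-\wedge x_2\in L_0$ and either ($x_1=x_2$ and $g^-\wedge x_1\ll x_1\ll g$) or ($x_1\ne x_2$, $x_1\wedge x_2\in L_0$, $g-x_1=x_2$ and $g-x_2=x_1$). The signature in $L_0$ of such a primitive tuple is the triple $(g,\{g^-\wedge x_1,g^-\wedge x_2\},\mathrm{Card}\{x_1,x_2\})$ where $g=g(x_1,L_0)$. -}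

module Defs where

open import Level using (Level; suc; _⊔_)
open import Data.Nat using (ℕ)
open import Data.Fin using (Fin)
open import Data.List using (List; foldr)
open import Data.List.Membership.Propositional using (_∈_)
open import Data.Product using (Σ; ∃; ∃-syntax; _×_; _,_)
open import Data.Sum using (_⊎_)
open import Relation.Nullary using (¬_)
open import Relation.Binary.PropositionalEquality using (_≡_; _≢_)
open import Function.Bundles using (_↔_; _⇔_)
open import Function.Definitions using (Injective; Bijective)

record CoHeyting : Set₁ where
  infixr 6 _∨_
  infixr 7 _∧_
  infixl 8 _-_
  infix 4 _≤_
  field
    Carrier : Set
    𝟎 𝟏 : Carrier
    _∨_ _∧_ _-_ : Carrier → Carrier → Carrier
    ∨-comm : ∀ a b → a ∨ b ≡ b ∨ a
    ∧-comm : ∀ a b → a ∧ b ≡ b ∧ a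
    ∨-assoc : ∀ a b c → (a ∨ b) ∨ c ≡ a ∨ (b ∨ c)
    ∧-assoc : ∀ a b c → (a ∧ b) ∧ c ≡ a ∧ (b ∧ c)
    ∨-absorbs-∧ : ∀ a b → a ∨ (a ∧ b) ≡ a
    ∧-absorbs-∨ : ∀ a b → a ∧ (a ∨ b) ≡ a
    ∧-distrib-∨ : ∀ a b c → a ∧ (b ∨ c) ≡ (a ∧ b) ∨ (a ∧ c)
    ∨-identity : ∀ a → a ∨ 𝟎 ≡ a
    ∧-identity : ∀ a → a ∧ 𝟏 ≡ a

  _≤_ : Carrier → Carrier → Set
  a ≤ b = a ∧ b ≡ a

  _<_ : Carrier → Carrier → Set
  a < b = a ≤ b × a ≢ b

  field
    -‿covers : ∀ a b → a ≤ b ∨ (a - b)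
    -‿least  : ∀ a b c → a ≤ b ∨ c → a - b ≤ c

  _≪_ : Carrier → Carrier → Set
  b ≪ a = (a - b ≡ a) × b ≤ a

  ⋁ : List Carrier → Carrier
  ⋁ = foldr _∨_ 𝟎

  JoinIrreducible : Carrier → Set
  JoinIrreducible a = ∀ (S : List Carrier) → ¬ (a ∈ S) → a ≢ ⋁ S

  -- a⁻ = ⋁ { b : b < a }  (characterised as the least upper bound of
  -- the strict lower bounds of a; in a finite lattice this is the join)
  IsMinusOf : Carrier → Carrier → Set
  IsMinusOf a m = (∀ b → b < a → b ≤ m) × (∀ c → (∀ b → b < a → b ≤ c) → m ≤ c)

open CoHeyting public using (Carrier)

Finite : Set → Set
Finite A = ∃[ n ] (A ↔ Fin n)

record IsHom (A B : CoHeyting) (f : Carrier A → Carrier B) : Set where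
  private
    module A = CoHeyting A
    module B = CoHeyting B
  field
    pres-𝟎 : f A.𝟎 ≡ B.𝟎
    pres-𝟏 : f A.𝟏 ≡ B.𝟏
    pres-∨ : ∀ a b → f (a A.∨ b) ≡ f a B.∨ f b
    pres-∧ : ∀ a b → f (a A.∧ b) ≡ f a B.∧ f b
    pres-- : ∀ a b → f (a A.- b) ≡ f a B.- f b

-- L₀ is (identified with) a subalgebra of L via the injective
-- homomorphism e
IsEmbedding : (L₀ L : CoHeyting) → (Carrier L₀ → Carrier L) → Set
IsEmbedding L₀ L e = IsHom L₀ L e × Injective _≡_ _≡_ e

IsIso : (A B : CoHeyting) → (Carrier A → Carrier B) → Set
IsIso A B f = IsHom A B f × Bijective _≡_ _≡_ f

module _ (L₀ L : CoHeyting) (e : Carrier L₀ → Carrier L) where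
  private
    module L₀ = CoHeyting L₀
    module L = CoHeyting L

  InSub : Carrier L → Set
  InSub x = ∃[ a ] (e a ≡ x)

  ClosedSub : (Carrier L → Set) → Set
  ClosedSub P = P L.𝟎 × P L.𝟏
    × (∀ a b → P a → P b → P (a L.∨ b))
    × (∀ a b → P a → P b → P (a L.∧ b))
    × (∀ a b → P a → P b → P (a L.- b))

  GeneratedBy : Carrier L → Carrier L → Set₁
  GeneratedBy x₁ x₂ = ∀ (P : Carrier L → Set) → ClosedSub P
    → (∀ a → P (e a)) → P x₁ → P x₂ → ∀ y → P y

  -- g(x, L₀) = ⋀ { a ∈ L₀ : x ≤ a }  (greatest lower bound in L₀;
  -- since L₀ is a finite sublattice this is the meet)
  IsGOf : Carrier L → Carrier L₀ → Set
  IsGOf x g = (∀ a → x L.≤ e a → g L₀.≤ a)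
            × (∀ c → (∀ a → x L.≤ e a → c L₀.≤ a) → c L₀.≤ g)

  Primitive : Carrier L → Carrier L → Set
  Primitive x₁ x₂ = ¬ InSub x₁ × ¬ InSub x₂ ×
    ∃[ g ] ∃[ g⁻ ] (L₀.JoinIrreducible g × L₀.IsMinusOf g g⁻
      × InSub (e g⁻ L.∧ x₁) × InSub (e g⁻ L.∧ x₂)
      × ( (x₁ ≡ x₂ × (e g⁻ L.∧ x₁) L.≪ x₁ × x₁ L.≪ e g)
        ⊎ (x₁ ≢ x₂ × InSub (x₁ L.∧ x₂)
           × e g L.- x₁ ≡ x₂ × e g L.- x₂ ≡ x₁)))

  -- The signature of (x₁ , x₂) in L₀ is (g , S , k), where
  -- g = g(x₁, L₀), S = {g⁻ ∧ x₁ , g⁻ ∧ x₂} ⊆ L₀ (as a predicate on L₀)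
  -- and k = Card {x₁ , x₂}.
  HasSignature : Carrier L → Carrier L →
                 Carrier L₀ → (Carrier L₀ → Set) → ℕ → Set
  HasSignature x₁ x₂ g S k = IsGOf x₁ g
    × (∃[ g⁻ ] (L₀.IsMinusOf g g⁻
        × (∀ a → S a ⇔ (e a ≡ e g⁻ L.∧ x₁ ⊎ e a ≡ e g⁻ L.∧ x₂))))
    × (x₁ ≡ x₂ → k ≡ 1) × (x₁ ≢ x₂ → k ≡ 2)

module Submission where

-- Every element of L is e a ∨ x₁ ∨ x₂ for some a ∈ L₀, with some of the generators possibly
-- dropped. Since xᵢ ≤ g and g is join prime, for b ∈ L₀ the elements xᵢ ∧ b, xᵢ - b and b - xᵢ
-- are determined by data living in L₀, namely g, mᵢ = g⁻ ∧ xᵢ and whether x₁ = x₂: according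
-- as g ≤ b or not, xᵢ ∧ b is xᵢ or mᵢ ∧ b and xᵢ - b is 𝟎 or xᵢ, while b - xᵢ is b - mᵢ when
-- g ≰ b, and for g ≤ b it is b if x₁ = x₂ and (b - g) ∨ x_other otherwise. So the co-Heyting
-- operations act on formal triples (a , s₁ , s₂) by the same formulas in L₁ and L₂. Equality
-- of values is decided by a canonical form of the triple, again computed in L₀, so sending
-- the value of a triple in L₁ to its value in L₂ is a well-defined isomorphism fixing L₀.

open import Algebra.Bundles using (IdempotentCommutativeMonoid)
import Algebra.Solver.IdempotentCommutativeMonoid as ICMSolver
open import Data.Bool using (Bool; true; false; if_then_else_) renaming (_∨_ to _or_)
open import Data.Empty using (⊥-elim)
open import Data.Fin.Properties using () renaming (_≟_ to _≟ᶠ_)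
open import Data.List using ([]; _∷_)
open import Data.List.Membership.Propositional using (_∈_)
open import Data.List.Relation.Unary.Any using (here; there)
open import Data.Nat using (ℕ)
open import Data.Product using (Σ; ∃-syntax; _×_; _,_; proj₁; proj₂)
open import Data.Sum using (_⊎_; inj₁; inj₂; [_,_]) renaming (map to ⊎-map)
open import Function.Base using (_∘_)
open import Function.Bundles using (Equivalence; _⇔_; mk⇔; mk↣)
open import Function.Definitions using (Injective; Surjective)
open import Function.Properties.Inverse using (↔⇒↣)
open import Relation.Binary.Definitions using (DecidableEquality)
open import Relation.Binary.PropositionalEquality
  using (_≡_; _≢_; refl; sym; trans; cong; cong₂; subst; isEquivalence; module ≡-Reasoning)
open import Relation.Nullary using (Dec; yes; no; does; ¬_)
open import Relation.Nullary.Decidable using (via-injection)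
open import Relation.Unary using (Decidable)

open import Defs

finite⇒≟ : ∀ {A : Set} → Finite A → DecidableEquality A
finite⇒≟ (_ , A↔Fin) = via-injection (↔⇒↣ A↔Fin) _≟ᶠ_

module CoHeytingProperties (L : CoHeyting) where
  open CoHeyting L public hiding (Carrier)

  ∧-idem : ∀ a → a ∧ a ≡ a
  ∧-idem a = trans (cong (a ∧_) (sym (∨-absorbs-∧ a a))) (∧-absorbs-∨ a (a ∧ a))

  ∨-idem : ∀ a → a ∨ a ≡ a
  ∨-idem a = trans (cong (a ∨_) (sym (∧-absorbs-∨ a a))) (∨-absorbs-∧ a (a ∨ a))

  ∨-identityˡ : ∀ a → 𝟎 ∨ a ≡ a
  ∨-identityˡ a = trans (∨-comm 𝟎 a) (∨-identity a)

  ∧-distribʳ-∨ : ∀ a b c → (b ∨ c) ∧ a ≡ (b ∧ a) ∨ (c ∧ a)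
  ∧-distribʳ-∨ a b c = trans (∧-comm (b ∨ c) a)
    (trans (∧-distrib-∨ a b c) (cong₂ _∨_ (∧-comm a b) (∧-comm a c)))

  ∨-icm : IdempotentCommutativeMonoid _ _
  ∨-icm = record
    { Carrier = Carrier L
    ; _≈_ = _≡_
    ; _∙_ = _∨_
    ; ε = 𝟎
    ; isIdempotentCommutativeMonoid = record
      { isCommutativeMonoid = record
        { isMonoid = record
          { isSemigroup = record
            { isMagma = record { isEquivalence = isEquivalence ; ∙-cong = cong₂ _∨_ }
            ; assoc = ∨-assoc }
          ; identity = ∨-identityˡ , ∨-identity }
        ; comm = ∨-comm }
      ; idem = ∨-idem }
    }

  module ∨-Solver = ICMSolver ∨-icm

  [x∨y]∨z≡x∨[z∨y] : ∀ a b c → (a ∨ b) ∨ c ≡ a ∨ (c ∨ b)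
  [x∨y]∨z≡x∨[z∨y] = solve 3 (λ a b c → (a ⊕ b) ⊕ c ⊜ a ⊕ (c ⊕ b)) refl
    where open ∨-Solver

  ≤-refl : ∀ {a} → a ≤ a
  ≤-refl {a} = ∧-idem a

  ≤-reflexive : ∀ {a b} → a ≡ b → a ≤ b
  ≤-reflexive refl = ≤-refl

  ≤-trans : ∀ {a b c} → a ≤ b → b ≤ c → a ≤ c
  ≤-trans {a} {b} {c} a≤b b≤c = begin
    a ∧ c       ≡⟨ cong (_∧ c) a≤b ⟨
    (a ∧ b) ∧ c ≡⟨ ∧-assoc a b c ⟩
    a ∧ (b ∧ c) ≡⟨ cong (a ∧_) b≤c ⟩
    a ∧ b       ≡⟨ a≤b ⟩
    a           ∎
    where open ≡-Reasoning

  ≤-antisym : ∀ {a b} → a ≤ b → b ≤ a → a ≡ b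
  ≤-antisym {a} {b} a≤b b≤a = trans (sym a≤b) (trans (∧-comm a b) b≤a)

  ≤⇒∨≡ : ∀ {a b} → a ≤ b → a ∨ b ≡ b
  ≤⇒∨≡ {a} {b} a≤b = begin
    a ∨ b       ≡⟨ cong (_∨ b) a≤b ⟨
    (a ∧ b) ∨ b ≡⟨ ∨-comm (a ∧ b) b ⟩
    b ∨ (a ∧ b) ≡⟨ cong (b ∨_) (∧-comm a b) ⟩
    b ∨ (b ∧ a) ≡⟨ ∨-absorbs-∧ b a ⟩
    b           ∎
    where open ≡-Reasoning

  x∧y≤x : ∀ a b → a ∧ b ≤ a
  x∧y≤x a b = begin
    (a ∧ b) ∧ a ≡⟨ ∧-comm (a ∧ b) a ⟩
    a ∧ (a ∧ b) ≡⟨ ∧-assoc a a b ⟨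
    (a ∧ a) ∧ b ≡⟨ cong (_∧ b) (∧-idem a) ⟩
    a ∧ b       ∎
    where open ≡-Reasoning

  x∧y≤y : ∀ a b → a ∧ b ≤ b
  x∧y≤y a b = subst (_≤ b) (∧-comm b a) (x∧y≤x b a)

  ∧-greatest : ∀ {a b c} → c ≤ a → c ≤ b → c ≤ a ∧ b
  ∧-greatest {a} {b} {c} c≤a c≤b = trans (sym (∧-assoc c a b)) (trans (cong (_∧ b) c≤a) c≤b)

  x≤x∨y : ∀ a b → a ≤ a ∨ b
  x≤x∨y = ∧-absorbs-∨

  y≤x∨y : ∀ a b → b ≤ a ∨ b
  y≤x∨y a b = subst (b ≤_) (∨-comm b a) (x≤x∨y b a)

  ∨-least : ∀ {a b c} → a ≤ c → b ≤ c → a ∨ b ≤ c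
  ∨-least {a} {b} {c} a≤c b≤c = trans (cong ((a ∨ b) ∧_) (sym a∨b∨c≡c)) (∧-absorbs-∨ (a ∨ b) c)
    where
      a∨b∨c≡c : (a ∨ b) ∨ c ≡ c
      a∨b∨c≡c = trans (∨-assoc a b c) (trans (cong (a ∨_) (≤⇒∨≡ b≤c)) (≤⇒∨≡ a≤c))

  ∨-mono-≤ : ∀ {a b c d} → a ≤ c → b ≤ d → a ∨ b ≤ c ∨ d
  ∨-mono-≤ {c = c} {d} a≤c b≤d = ∨-least (≤-trans a≤c (x≤x∨y c d)) (≤-trans b≤d (y≤x∨y c d))

  ∧-mono-≤ : ∀ {a b c d} → a ≤ c → b ≤ d → a ∧ b ≤ c ∧ d
  ∧-mono-≤ {a} {b} a≤c b≤d = ∧-greatest (≤-trans (x∧y≤x a b) a≤c) (≤-trans (x∧y≤y a b) b≤d)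

  𝟎-minimum : ∀ a → 𝟎 ≤ a
  𝟎-minimum a = subst (λ b → 𝟎 ∧ b ≡ 𝟎) (∨-identityˡ a) (∧-absorbs-∨ 𝟎 a)

  ≤∨⇒≤∧∨ : ∀ {a b c} → a ≤ b ∨ c → a ≤ (a ∧ b) ∨ c
  ≤∨⇒≤∧∨ {a} {b} {c} a≤b∨c = ≤-trans (∧-greatest ≤-refl a≤b∨c)
    (subst (_≤ (a ∧ b) ∨ c) (sym (∧-distrib-∨ a b c)) (∨-mono-≤ ≤-refl (x∧y≤y a c)))

  x-y≤z : ∀ {a b c} → a ≤ b ∨ c → a - b ≤ c
  x-y≤z {a} {b} {c} = -‿least a b c

  x-y≤x : ∀ a b → a - b ≤ a
  x-y≤x a b = x-y≤z (y≤x∨y b a)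

  -‿monoˡ-≤ : ∀ {a a′ b} → a ≤ a′ → a - b ≤ a′ - b
  -‿monoˡ-≤ {a′ = a′} {b} a≤a′ = x-y≤z (≤-trans a≤a′ (-‿covers a′ b))

  -‿antitoneʳ-≤ : ∀ {a b b′} → b ≤ b′ → a - b′ ≤ a - b
  -‿antitoneʳ-≤ {a} {b} b≤b′ = x-y≤z (≤-trans (-‿covers a b) (∨-mono-≤ b≤b′ ≤-refl))

  x≤y⇒x-y≡𝟎 : ∀ {a b} → a ≤ b → a - b ≡ 𝟎
  x≤y⇒x-y≡𝟎 {a} {b} a≤b =
    ≤-antisym (x-y≤z (subst (a ≤_) (sym (∨-identity b)) a≤b)) (𝟎-minimum _)

  x-x≡𝟎 : ∀ a → a - a ≡ 𝟎
  x-x≡𝟎 a = x≤y⇒x-y≡𝟎 ≤-refl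

  𝟎-x≡𝟎 : ∀ a → 𝟎 - a ≡ 𝟎
  𝟎-x≡𝟎 a = x≤y⇒x-y≡𝟎 (𝟎-minimum a)

  x-𝟎≡x : ∀ a → a - 𝟎 ≡ a
  x-𝟎≡x a = ≤-antisym (x-y≤x a 𝟎) (subst (a ≤_) (∨-identityˡ (a - 𝟎)) (-‿covers a 𝟎))

  -‿distribʳ-∨ : ∀ a b c → (a ∨ b) - c ≡ (a - c) ∨ (b - c)
  -‿distribʳ-∨ a b c = ≤-antisym
    (x-y≤z (∨-least (≤-trans (-‿covers a c) (∨-mono-≤ ≤-refl (x≤x∨y _ _)))
                    (≤-trans (-‿covers b c) (∨-mono-≤ ≤-refl (y≤x∨y _ _)))))
    (∨-least (-‿monoˡ-≤ (x≤x∨y a b)) (-‿monoˡ-≤ (y≤x∨y a b)))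

  x-[y∨z]≡x-y-z : ∀ a b c → a - (b ∨ c) ≡ (a - b) - c
  x-[y∨z]≡x-y-z a b c = ≤-antisym
    (x-y≤z (≤-trans (-‿covers a b)
      (subst (b ∨ (a - b) ≤_) (sym (∨-assoc b c ((a - b) - c)))
        (∨-mono-≤ ≤-refl (-‿covers (a - b) c)))))
    (x-y≤z (x-y≤z (subst (a ≤_) (∨-assoc b c _) (-‿covers a (b ∨ c)))))

  ≤-decidable : DecidableEquality (Carrier L) → ∀ a b → Dec (a ≤ b)
  ≤-decidable _≟_ a b = (a ∧ b) ≟ a

  JoinPrime : Carrier L → Set
  JoinPrime g = ∀ {a b} → g ≤ a ∨ b → g ≤ a ⊎ g ≤ b

  -- Constructively, irreducibility yields primality only once g ≤ _ is decidable.
  join-irreducible⇒prime : DecidableEquality (Carrier L) → ∀ {g} → JoinIrreducible g → JoinPrime g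
  join-irreducible⇒prime _≟_ {g} g-irr {a} {b} g≤a∨b with ≤-decidable _≟_ g a | ≤-decidable _≟_ g b
  ... | yes g≤a | _       = inj₁ g≤a
  ... | no _    | yes g≤b = inj₂ g≤b
  ... | no g≰a  | no g≰b  = ⊥-elim (g-irr (g ∧ a ∷ g ∧ b ∷ []) g∉ g≡⋁)
    where
      g∉ : ¬ (g ∈ (g ∧ a ∷ g ∧ b ∷ []))
      g∉ (here g≡g∧a) = g≰a (sym g≡g∧a)
      g∉ (there (here g≡g∧b)) = g≰b (sym g≡g∧b)
      g≡⋁ : g ≡ ⋁ (g ∧ a ∷ g ∧ b ∷ [])
      g≡⋁ = trans (sym g≤a∨b)
        (trans (∧-distrib-∨ g a b) (cong (g ∧ a ∨_) (sym (∨-identity (g ∧ b)))))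

  prime-x-y≡x : ∀ {g a} → JoinPrime g → ¬ g ≤ a → g - a ≡ g
  prime-x-y≡x {g} {a} g-prime g≰a with g-prime (-‿covers g a)
  ... | inj₁ g≤a = ⊥-elim (g≰a g≤a)
  ... | inj₂ g≤g-a = ≤-antisym (x-y≤x g a) g≤g-a

  IsMinusOf-unique : ∀ {a m m′} → IsMinusOf a m → IsMinusOf a m′ → m ≡ m′
  IsMinusOf-unique (ub , least) (ub′ , least′) = ≤-antisym (least _ ub′) (least′ _ ub)

  ≤∧≱⇒≤minus : ∀ {a m b} → IsMinusOf a m → b ≤ a → ¬ a ≤ b → b ≤ m
  ≤∧≱⇒≤minus (ub , _) b≤a a≰b = ub _ (b≤a , λ b≡a → a≰b (≤-reflexive (sym b≡a)))

  ≱⇒∧≤minus : ∀ {a m b} → IsMinusOf a m → ¬ a ≤ b → a ∧ b ≤ m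
  ≱⇒∧≤minus {a} {b = b} a⁻ a≰b =
    ≤∧≱⇒≤minus a⁻ (x∧y≤x a b) (λ a≤a∧b → a≰b (≤-trans a≤a∧b (x∧y≤y a b)))

module HomProperties {A B : CoHeyting} {f : Carrier A → Carrier B} (hom : IsHom A B f) where
  open IsHom hom public
  private
    module A = CoHeyting A
    module B = CoHeyting B

  mono-≤ : ∀ {a b} → a A.≤ b → f a B.≤ f b
  mono-≤ {a} {b} a≤b = trans (sym (pres-∧ a b)) (cong f a≤b)

  cancel-≤ : Injective _≡_ _≡_ f → ∀ {a b} → f a B.≤ f b → a A.≤ b
  cancel-≤ inj {a} {b} fa≤fb = inj (trans (pres-∧ a b) fa≤fb)

-- Normal forms over L₀

data Idx : Set where
  i₁ i₂ : Idx

other : Idx → Idx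
other i₁ = i₂
other i₂ = i₁

module NormalForm (L₀ : CoHeyting) (g m₁ m₂ : Carrier L₀) (distinct : Bool)
                  (g≤? : Decidable (CoHeyting._≤_ L₀ g)) where
  open CoHeyting L₀ hiding (Carrier)

  -- (a , s₁ , s₂) stands for a ∨ x₁ ∨ x₂, where xᵢ is dropped when sᵢ is false.
  Form : Set
  Form = Carrier L₀ × Bool × Bool

  m : Idx → Carrier L₀
  m i₁ = m₁
  m i₂ = m₂

  flags : Idx → Bool × Bool
  flags i₁ = true , false
  flags i₂ = false , true

  const : Carrier L₀ → Form
  const a = a , false , false

  var : Idx → Form
  var i = 𝟎 , flags i

  𝟎ᶠ : Form
  𝟎ᶠ = const 𝟎

  when : Bool → Form → Form
  when true n = n
  when false n = 𝟎ᶠ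

  _∨ᶠ_ : Form → Form → Form
  (a , s₁ , s₂) ∨ᶠ (b , t₁ , t₂) = a ∨ b , s₁ or t₁ , s₂ or t₂

  varMeetConst : Idx → Carrier L₀ → Form
  varMeetConst i b = if does (g≤? b) then var i else const (m i ∧ b)

  varMeetVar : Idx → Idx → Form
  varMeetVar i₁ i₁ = var i₁
  varMeetVar i₂ i₂ = var i₂
  varMeetVar i₁ i₂ = if distinct then const (m₁ ∧ m₂) else var i₁
  varMeetVar i₂ i₁ = if distinct then const (m₁ ∧ m₂) else var i₂

  constMeet : Carrier L₀ → Form → Form
  constMeet a (b , t₁ , t₂) =
    const (a ∧ b) ∨ᶠ (when t₁ (varMeetConst i₁ a) ∨ᶠ when t₂ (varMeetConst i₂ a))

  varMeet : Idx → Form → Form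
  varMeet i (b , t₁ , t₂) =
    varMeetConst i b ∨ᶠ (when t₁ (varMeetVar i i₁) ∨ᶠ when t₂ (varMeetVar i i₂))

  _∧ᶠ_ : Form → Form → Form
  (a , s₁ , s₂) ∧ᶠ n = constMeet a n ∨ᶠ (when s₁ (varMeet i₁ n) ∨ᶠ when s₂ (varMeet i₂ n))

  minusConst : Form → Carrier L₀ → Form
  minusConst (a , s₁ , s₂) b = if does (g≤? b) then const (a - b) else (a - b , s₁ , s₂)

  constMinusVar : Idx → Carrier L₀ → Form
  constMinusVar i a =
    if does (g≤? a)
    then (if distinct then (a - g , flags (other i)) else const a)
    else const (a - m i)

  varMinusVar : Idx → Idx → Form
  varMinusVar i₁ i₁ = 𝟎ᶠ
  varMinusVar i₂ i₂ = 𝟎ᶠ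
  varMinusVar i₁ i₂ = if distinct then var i₁ else 𝟎ᶠ
  varMinusVar i₂ i₁ = if distinct then var i₂ else 𝟎ᶠ

  minusVar : Idx → Form → Form
  minusVar i (a , s₁ , s₂) =
    constMinusVar i a ∨ᶠ (when s₁ (varMinusVar i₁ i) ∨ᶠ when s₂ (varMinusVar i₂ i))

  applyWhen : Bool → (Form → Form) → Form → Form
  applyWhen true f n = f n
  applyWhen false f n = n

  _-ᶠ_ : Form → Form → Form
  n -ᶠ (b , t₁ , t₂) = applyWhen t₂ (minusVar i₂) (applyWhen t₁ (minusVar i₁) (minusConst n b))

  reduce : Carrier L₀ → Bool → Bool → Form
  reduce a false false = const a
  reduce a true false = a ∨ m₁ , flags i₁
  reduce a false true = if distinct then (a ∨ m₂ , flags i₂) else (a ∨ m₁ , flags i₁)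
  reduce a true true = if distinct then const (a ∨ g) else (a ∨ m₁ , flags i₁)

  canonical : Form → Form
  canonical (a , s₁ , s₂) = if does (g≤? a) then const a else reduce a s₁ s₂

module _ (L₀ L : CoHeyting) (e : Carrier L₀ → Carrier L) where
  private
    module L = CoHeyting L

  data Shape (g g⁻ : Carrier L₀) (x₁ x₂ : Carrier L) : Bool → Set where
    equal : x₁ ≡ x₂ → (e g⁻ L.∧ x₁) L.≪ x₁ → x₁ L.≪ e g → Shape g g⁻ x₁ x₂ false
    complementary : InSub L₀ L e (x₁ L.∧ x₂) → e g L.- x₁ ≡ x₂ → e g L.- x₂ ≡ x₁ →
                    Shape g g⁻ x₁ x₂ true

  -- A primitive tuple generating L over L₀, with g = g(x₁, L₀), mᵢ = g⁻ ∧ xᵢ and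
  -- distinct recording whether Card {x₁, x₂} = 2.
  record Presentation (g g⁻ m₁ m₂ : Carrier L₀) (distinct : Bool) : Set₁ where
    field
      x₁ x₂ : Carrier L
      x₁∉L₀ : ¬ InSub L₀ L e x₁
      x₂∉L₀ : ¬ InSub L₀ L e x₂
      m₁-def : e m₁ ≡ e g⁻ L.∧ x₁
      m₂-def : e m₂ ≡ e g⁻ L.∧ x₂
      shape : Shape g g⁻ x₁ x₂ distinct
      generated : GeneratedBy L₀ L e x₁ x₂

module _ {L₀ L : CoHeyting} {e : Carrier L₀ → Carrier L} where
  private
    module L = CoHeytingProperties L

  shape-≤ : ∀ {g g⁻ x₁ x₂ d} → Shape L₀ L e g g⁻ x₁ x₂ d → x₁ L.≤ e g × x₂ L.≤ e g
  shape-≤ {g} (equal x₁≡x₂ _ (_ , x₁≤g)) = x₁≤g , subst (L._≤ e g) x₁≡x₂ x₁≤g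
  shape-≤ {g} {x₁ = x₁} {x₂} (complementary _ g-x₁≡x₂ g-x₂≡x₁) =
    subst (L._≤ e g) g-x₂≡x₁ (L.x-y≤x (e g) x₂) , subst (L._≤ e g) g-x₁≡x₂ (L.x-y≤x (e g) x₁)

  shape-swap : ∀ {g g⁻ x₁ x₂ d} → Shape L₀ L e g g⁻ x₁ x₂ d → Shape L₀ L e g g⁻ x₂ x₁ d
  shape-swap (equal refl m≪x x≪g) = equal refl m≪x x≪g
  shape-swap {x₁ = x₁} {x₂} (complementary (c , c≡x₁∧x₂) g-x₁≡x₂ g-x₂≡x₁) =
    complementary (c , trans c≡x₁∧x₂ (L.∧-comm x₁ x₂)) g-x₂≡x₁ g-x₁≡x₂

  swap : ∀ {g g⁻ m₁ m₂ d} → Presentation L₀ L e g g⁻ m₁ m₂ d → Presentation L₀ L e g g⁻ m₂ m₁ d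
  swap P = record
    { x₁ = x₂ ; x₂ = x₁ ; x₁∉L₀ = x₂∉L₀ ; x₂∉L₀ = x₁∉L₀ ; m₁-def = m₂-def ; m₂-def = m₁-def
    ; shape = shape-swap shape
    ; generated = λ Q closed L₀⊆Q x₂∈Q x₁∈Q → generated Q closed L₀⊆Q x₁∈Q x₂∈Q
    }
    where open Presentation P

  align : ∀ {g g⁻ m₁ m₂ m₁′ m₂′ d} → Presentation L₀ L e g g⁻ m₁′ m₂′ d →
          (m₁ ≡ m₁′ × m₂ ≡ m₂′) ⊎ (m₁ ≡ m₂′ × m₂ ≡ m₁′) → Presentation L₀ L e g g⁻ m₁ m₂ d
  align P (inj₁ (refl , refl)) = P
  align P (inj₂ (refl , refl)) = swap P

-- Normal forms realised in an algebra generated by a primitive tuple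

module Realisation
  (L₀ L : CoHeyting) {e : Carrier L₀ → Carrier L}
  (e-hom : IsHom L₀ L e) (e-inj : Injective _≡_ _≡_ e)
  {g g⁻ : Carrier L₀} (g-prime : CoHeytingProperties.JoinPrime L₀ g)
  (g⁻-def : CoHeyting.IsMinusOf L₀ g g⁻) (g≤? : Decidable (CoHeyting._≤_ L₀ g))
  {m₁ m₂ : Carrier L₀} {distinct : Bool} (P : Presentation L₀ L e g g⁻ m₁ m₂ distinct)
  where

  private
    module A = CoHeytingProperties L₀
    module H = HomProperties e-hom
  open CoHeytingProperties L
  open Presentation P
  open NormalForm L₀ g m₁ m₂ distinct g≤?

  PShape : Bool → Set
  PShape = Shape L₀ L e g g⁻ x₁ x₂

  x : Idx → Carrier L
  x i₁ = x₁
  x i₂ = x₂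

  m-def : ∀ i → e (m i) ≡ e g⁻ ∧ x i
  m-def i₁ = m₁-def
  m-def i₂ = m₂-def

  x∉L₀ : ∀ i → ¬ InSub L₀ L e (x i)
  x∉L₀ i₁ = x₁∉L₀
  x∉L₀ i₂ = x₂∉L₀

  x≤g : ∀ i → x i ≤ e g
  x≤g i₁ = proj₁ (shape-≤ shape)
  x≤g i₂ = proj₂ (shape-≤ shape)

  m≤x : ∀ i → e (m i) ≤ x i
  m≤x i = subst (_≤ x i) (sym (m-def i)) (x∧y≤y (e g⁻) (x i))

  m≤g⁻ : ∀ i → m i A.≤ g⁻
  m≤g⁻ i = H.cancel-≤ e-inj (subst (_≤ e g⁻) (sym (m-def i)) (x∧y≤x (e g⁻) (x i)))

  -- Otherwise x₁ ≤ e g ≤ e g⁻ would make x₁ = g⁻ ∧ x₁ = m₁ an element of L₀.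
  g≰g⁻ : ¬ g A.≤ g⁻
  g≰g⁻ g≤g⁻ = x∉L₀ i₁ (m₁ , trans (m-def i₁)
    (≤-antisym (x∧y≤y _ _) (∧-greatest (≤-trans (x≤g i₁) (H.mono-≤ g≤g⁻)) ≤-refl)))

  g≰a∨m : ∀ i {a} → ¬ g A.≤ a → ¬ g A.≤ a A.∨ m i
  g≰a∨m i g≰a g≤a∨m with g-prime g≤a∨m
  ... | inj₁ g≤a = g≰a g≤a
  ... | inj₂ g≤m = g≰g⁻ (A.≤-trans g≤m (m≤g⁻ i))

  x∧a≤m : ∀ i {a} → ¬ g A.≤ a → x i ∧ e a ≤ e (m i)
  x∧a≤m i {a} g≰a = subst (x i ∧ e a ≤_) (sym (m-def i))
    (∧-greatest (≤-trans (∧-mono-≤ (x≤g i) ≤-refl)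
                  (subst (_≤ e g⁻) (H.pres-∧ g a) (H.mono-≤ (A.≱⇒∧≤minus g⁻-def g≰a))))
                (x∧y≤x _ _))

  ≤x⇒≤m : ∀ i {c} → e c ≤ x i → c A.≤ m i
  ≤x⇒≤m i {c} c≤x = H.cancel-≤ e-inj (subst (e c ≤_) (sym (m-def i))
      (∧-greatest (H.mono-≤ (A.≤∧≱⇒≤minus g⁻-def c≤g g≰c)) c≤x))
    where
      c≤g : c A.≤ g
      c≤g = H.cancel-≤ e-inj (≤-trans c≤x (x≤g i))
      g≰c : ¬ g A.≤ c
      g≰c g≤c = x∉L₀ i (g , ≤-antisym (≤-trans (H.mono-≤ g≤c) c≤x) (x≤g i))

  x-a≡𝟎 : ∀ i {a} → g A.≤ a → x i - e a ≡ 𝟎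
  x-a≡𝟎 i g≤a = x≤y⇒x-y≡𝟎 (≤-trans (x≤g i) (H.mono-≤ g≤a))

  a-x≡a-m : ∀ i {a} → ¬ g A.≤ a → e a - x i ≡ e (a A.- m i)
  a-x≡a-m i {a} g≰a =
    trans (≤-antisym (-‿antitoneʳ-≤ (m≤x i)) (x-y≤z a≤m∨[a-x])) (sym (H.pres-- a (m i)))
    where
      a≤m∨[a-x] : e a ≤ e (m i) ∨ (e a - x i)
      a≤m∨[a-x] = ≤-trans (≤∨⇒≤∧∨ (-‿covers (e a) (x i)))
        (∨-mono-≤ (subst (_≤ e (m i)) (∧-comm (x i) (e a)) (x∧a≤m i g≰a)) ≤-refl)

  module Equal (x₁≡x₂ : x₁ ≡ x₂) (m₁≪x₁ : (e g⁻ ∧ x₁) ≪ x₁) (x₁≪g : x₁ ≪ e g) where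
    x≡x₁ : ∀ i → x i ≡ x₁
    x≡x₁ i₁ = refl
    x≡x₁ i₂ = sym x₁≡x₂

    x-m≡x : ∀ i → x i - e (m i) ≡ x i
    x-m≡x i = trans (cong (x i -_) (m-def i))
      (subst (λ y → y - (e g⁻ ∧ y) ≡ y) (sym (x≡x₁ i)) (proj₁ m₁≪x₁))

    g-x≡g : ∀ i → e g - x i ≡ e g
    g-x≡g i = subst (λ y → e g - y ≡ e g) (sym (x≡x₁ i)) (proj₁ x₁≪g)

    a-x≡a : ∀ i {a} → g A.≤ a → e a - x i ≡ e a
    a-x≡a i {a} g≤a = ≤-antisym (x-y≤x (e a) (x i))
        (≤-trans (-‿covers (e a) (x i)) (∨-least (≤-trans (x≤g i) g≤a-x) ≤-refl))
      where
        g≤a-x : e g ≤ e a - x i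
        g≤a-x = subst (_≤ e a - x i) (g-x≡g i) (-‿monoˡ-≤ (H.mono-≤ g≤a))

  module Complementary (x₁∧x₂∈L₀ : InSub L₀ L e (x₁ ∧ x₂))
                       (g-x₁≡x₂ : e g - x₁ ≡ x₂) (g-x₂≡x₁ : e g - x₂ ≡ x₁) where
    g-x≡x′ : ∀ i → e g - x i ≡ x (other i)
    g-x≡x′ i₁ = g-x₁≡x₂
    g-x≡x′ i₂ = g-x₂≡x₁

    g-x′≡x : ∀ i → e g - x (other i) ≡ x i
    g-x′≡x i₁ = g-x₂≡x₁
    g-x′≡x i₂ = g-x₁≡x₂

    g≤x∨x′ : ∀ i → e g ≤ x i ∨ x (other i)
    g≤x∨x′ i = subst (e g ≤_) (trans (cong (x (other i) ∨_) (g-x′≡x i)) (∨-comm _ _))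
                 (-‿covers (e g) (x (other i)))

    g≡x₁∨x₂ : e g ≡ x₁ ∨ x₂
    g≡x₁∨x₂ = ≤-antisym (g≤x∨x′ i₁) (∨-least (x≤g i₁) (x≤g i₂))

    x-x′≡x : ∀ i → x i - x (other i) ≡ x i
    x-x′≡x i = begin
      x i - x (other i)                 ≡⟨ cong (_- x (other i)) (g-x′≡x i) ⟨
      (e g - x (other i)) - x (other i) ≡⟨ x-[y∨z]≡x-y-z _ _ _ ⟨
      e g - (x (other i) ∨ x (other i)) ≡⟨ cong (e g -_) (∨-idem _) ⟩
      e g - x (other i)                 ≡⟨ g-x′≡x i ⟩
      x i                               ∎
      where open ≡-Reasoning

    x₁∧x₂≡m₁∧m₂ : x₁ ∧ x₂ ≡ e (m₁ A.∧ m₂)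
    x₁∧x₂≡m₁∧m₂ = ≤-antisym
      (subst (_≤ e (m₁ A.∧ m₂)) c≡x₁∧x₂
        (H.mono-≤ (A.∧-greatest (≤x⇒≤m i₁ (≤-trans c≤x₁∧x₂ (x∧y≤x x₁ x₂)))
                                (≤x⇒≤m i₂ (≤-trans c≤x₁∧x₂ (x∧y≤y x₁ x₂))))))
      (subst (_≤ x₁ ∧ x₂) (sym (H.pres-∧ m₁ m₂)) (∧-mono-≤ (m≤x i₁) (m≤x i₂)))
      where
        c = proj₁ x₁∧x₂∈L₀
        c≡x₁∧x₂ : e c ≡ x₁ ∧ x₂
        c≡x₁∧x₂ = proj₂ x₁∧x₂∈L₀
        c≤x₁∧x₂ : e c ≤ x₁ ∧ x₂
        c≤x₁∧x₂ = ≤-reflexive c≡x₁∧x₂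

    a-x≡[a-g]∨x′ : ∀ i {a} → g A.≤ a → e a - x i ≡ e (a A.- g) ∨ x (other i)
    a-x≡[a-g]∨x′ i {a} g≤a = ≤-antisym (x-y≤z a≤x∨[a-g]∨x′) (∨-least a-g≤a-x x′≤a-x)
      where
        a-g≤a-x : e (a A.- g) ≤ e a - x i
        a-g≤a-x = subst (_≤ e a - x i) (sym (H.pres-- a g)) (-‿antitoneʳ-≤ (x≤g i))
        x′≤a-x : x (other i) ≤ e a - x i
        x′≤a-x = subst (_≤ e a - x i) (g-x≡x′ i) (-‿monoˡ-≤ (H.mono-≤ g≤a))
        a≤x∨[a-g]∨x′ : e a ≤ x i ∨ (e (a A.- g) ∨ x (other i))
        a≤x∨[a-g]∨x′ = ≤-trans (subst (e a ≤_) (cong (e g ∨_) (sym (H.pres-- a g))) (-‿covers (e a) (e g)))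
          (≤-trans (∨-mono-≤ (g≤x∨x′ i) ≤-refl)
            (≤-reflexive ([x∨y]∨z≡x∨[z∨y] (x i) (x (other i)) (e (a A.- g)))))

  x-a≡x : ∀ i {a} → ¬ g A.≤ a → x i - e a ≡ x i
  x-a≡x i {a} g≰a = ≤-antisym (x-y≤x (x i) (e a)) (from-shape shape)
    where
      c = x i - e a
      x≤a∨c : x i ≤ e a ∨ c
      x≤a∨c = -‿covers (x i) (e a)
      from-shape : ∀ {d} → PShape d → x i ≤ c
      from-shape (equal x₁≡x₂ m₁≪x₁ x₁≪g) = subst (_≤ c) (x-m≡x i)
          (x-y≤z (≤-trans (≤∨⇒≤∧∨ x≤a∨c) (∨-mono-≤ (x∧a≤m i g≰a) ≤-refl)))
        where open Equal x₁≡x₂ m₁≪x₁ x₁≪g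
      from-shape (complementary x₁∧x₂∈L₀ g-x₁≡x₂ g-x₂≡x₁) = subst (_≤ c) (g-x′≡x i) (x-y≤z g≤x′∨c)
        where
          open Complementary x₁∧x₂∈L₀ g-x₁≡x₂ g-x₂≡x₁
          g≡g-a : e g ≡ e g - e a
          g≡g-a = trans (cong e (sym (A.prime-x-y≡x g-prime g≰a))) (H.pres-- g a)
          g≤x′∨c : e g ≤ x (other i) ∨ c
          g≤x′∨c = subst (_≤ x (other i) ∨ c) (sym g≡g-a)
            (x-y≤z (≤-trans (g≤x∨x′ i) (subst (x i ∨ x (other i) ≤_) ([x∨y]∨z≡x∨[z∨y] (e a) c (x (other i)))
              (∨-mono-≤ x≤a∨c ≤-refl))))

  opt : Bool → Carrier L → Carrier L
  opt true y = y
  opt false _ = 𝟎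

  ⟦_⟧ : Form → Carrier L
  ⟦ a , s₁ , s₂ ⟧ = e a ∨ (opt s₁ x₁ ∨ opt s₂ x₂)

  ⟦const⟧ : ∀ a → ⟦ const a ⟧ ≡ e a
  ⟦const⟧ a = trans (cong (e a ∨_) (∨-idem 𝟎)) (∨-identity (e a))

  ⟦𝟎ᶠ⟧ : ⟦ 𝟎ᶠ ⟧ ≡ 𝟎
  ⟦𝟎ᶠ⟧ = trans (⟦const⟧ A.𝟎) H.pres-𝟎

  ⟦flags⟧ : ∀ a i → ⟦ a , flags i ⟧ ≡ e a ∨ x i
  ⟦flags⟧ a i₁ = cong (e a ∨_) (∨-identity x₁)
  ⟦flags⟧ a i₂ = cong (e a ∨_) (∨-identityˡ x₂)

  ⟦var⟧ : ∀ i → ⟦ var i ⟧ ≡ x i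
  ⟦var⟧ i = trans (⟦flags⟧ A.𝟎 i) (trans (cong (_∨ x i) H.pres-𝟎) (∨-identityˡ (x i)))

  opt-𝟎 : ∀ s → opt s 𝟎 ≡ 𝟎
  opt-𝟎 true = refl
  opt-𝟎 false = refl

  opt-or : ∀ s t y → opt (s or t) y ≡ opt s y ∨ opt t y
  opt-or true true y = sym (∨-idem y)
  opt-or true false y = sym (∨-identity y)
  opt-or false t y = sym (∨-identityˡ _)

  opt-∧ : ∀ s y w → opt s y ∧ w ≡ opt s (y ∧ w)
  opt-∧ true y w = refl
  opt-∧ false y w = 𝟎-minimum w

  opt-minus : ∀ s y w → opt s y - w ≡ opt s (y - w)
  opt-minus true y w = refl
  opt-minus false y w = 𝟎-x≡𝟎 w

  ⟦∨ᶠ⟧ : ∀ n n′ → ⟦ n ∨ᶠ n′ ⟧ ≡ ⟦ n ⟧ ∨ ⟦ n′ ⟧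
  ⟦∨ᶠ⟧ (a , s₁ , s₂) (b , t₁ , t₂) = begin
    e (a A.∨ b) ∨ (opt (s₁ or t₁) x₁ ∨ opt (s₂ or t₂) x₂)
      ≡⟨ cong₂ _∨_ (H.pres-∨ a b) (cong₂ _∨_ (opt-or s₁ t₁ x₁) (opt-or s₂ t₂ x₂)) ⟩
    (e a ∨ e b) ∨ ((opt s₁ x₁ ∨ opt t₁ x₁) ∨ (opt s₂ x₂ ∨ opt t₂ x₂))
      ≡⟨ solve 6 (λ a b u₁ v₁ u₂ v₂ → (a ⊕ b) ⊕ ((u₁ ⊕ v₁) ⊕ (u₂ ⊕ v₂))
                                      ⊜ (a ⊕ (u₁ ⊕ u₂)) ⊕ (b ⊕ (v₁ ⊕ v₂)))
           refl (e a) (e b) (opt s₁ x₁) (opt t₁ x₁) (opt s₂ x₂) (opt t₂ x₂) ⟩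
    (e a ∨ (opt s₁ x₁ ∨ opt s₂ x₂)) ∨ (e b ∨ (opt t₁ x₁ ∨ opt t₂ x₂)) ∎
    where
      open ≡-Reasoning
      open ∨-Solver

  ⟦when⟧ : ∀ t n → ⟦ when t n ⟧ ≡ opt t ⟦ n ⟧
  ⟦when⟧ true n = refl
  ⟦when⟧ false n = ⟦𝟎ᶠ⟧

  ⟦∨when∨when⟧ : ∀ n s p t q →
    ⟦ n ∨ᶠ (when s p ∨ᶠ when t q) ⟧ ≡ ⟦ n ⟧ ∨ (opt s ⟦ p ⟧ ∨ opt t ⟦ q ⟧)
  ⟦∨when∨when⟧ n s p t q = trans (⟦∨ᶠ⟧ n _)
    (cong (⟦ n ⟧ ∨_) (trans (⟦∨ᶠ⟧ (when s p) (when t q)) (cong₂ _∨_ (⟦when⟧ s p) (⟦when⟧ t q))))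

  ⟦⟧∧ : ∀ a s₁ s₂ w → ⟦ a , s₁ , s₂ ⟧ ∧ w ≡ (e a ∧ w) ∨ (opt s₁ (x₁ ∧ w) ∨ opt s₂ (x₂ ∧ w))
  ⟦⟧∧ a s₁ s₂ w = trans (∧-distribʳ-∨ w (e a) _) (cong (e a ∧ w ∨_)
    (trans (∧-distribʳ-∨ w (opt s₁ x₁) (opt s₂ x₂)) (cong₂ _∨_ (opt-∧ s₁ x₁ w) (opt-∧ s₂ x₂ w))))

  ⟦⟧- : ∀ a s₁ s₂ w → ⟦ a , s₁ , s₂ ⟧ - w ≡ (e a - w) ∨ (opt s₁ (x₁ - w) ∨ opt s₂ (x₂ - w))
  ⟦⟧- a s₁ s₂ w = trans (-‿distribʳ-∨ (e a) _ w) (cong (e a - w ∨_)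
    (trans (-‿distribʳ-∨ (opt s₁ x₁) (opt s₂ x₂) w) (cong₂ _∨_ (opt-minus s₁ x₁ w) (opt-minus s₂ x₂ w))))

  ⟦varMeetConst⟧ : ∀ i b → ⟦ varMeetConst i b ⟧ ≡ x i ∧ e b
  ⟦varMeetConst⟧ i b with g≤? b
  ... | yes g≤b = trans (⟦var⟧ i) (sym (≤-trans (x≤g i) (H.mono-≤ g≤b)))
  ... | no g≰b = trans (⟦const⟧ (m i A.∧ b)) (trans (H.pres-∧ (m i) b)
    (≤-antisym (∧-mono-≤ (m≤x i) ≤-refl) (∧-greatest (x∧a≤m i g≰b) (x∧y≤y _ _))))

  ⟦varMeetVar⟧ : ∀ i j → ⟦ varMeetVar i j ⟧ ≡ x i ∧ x j
  ⟦varMeetVar⟧ = from-shape shape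
    where
      from-shape : PShape distinct → ∀ i j → ⟦ varMeetVar i j ⟧ ≡ x i ∧ x j
      from-shape _ i₁ i₁ = trans (⟦var⟧ i₁) (sym (∧-idem x₁))
      from-shape _ i₂ i₂ = trans (⟦var⟧ i₂) (sym (∧-idem x₂))
      from-shape (equal x₁≡x₂ _ _) i₁ i₂ =
        trans (⟦var⟧ i₁) (trans (sym (∧-idem x₁)) (cong (x₁ ∧_) x₁≡x₂))
      from-shape (equal x₁≡x₂ _ _) i₂ i₁ =
        trans (⟦var⟧ i₂) (trans (sym (∧-idem x₂)) (cong (x₂ ∧_) (sym x₁≡x₂)))
      from-shape (complementary p q r) i₁ i₂ =
        trans (⟦const⟧ _) (sym (Complementary.x₁∧x₂≡m₁∧m₂ p q r))
      from-shape (complementary p q r) i₂ i₁ =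
        trans (⟦const⟧ _) (trans (sym (Complementary.x₁∧x₂≡m₁∧m₂ p q r)) (∧-comm x₁ x₂))

  ⟦constMeet⟧ : ∀ a n → ⟦ constMeet a n ⟧ ≡ e a ∧ ⟦ n ⟧
  ⟦constMeet⟧ a (b , t₁ , t₂) = begin
    ⟦ constMeet a (b , t₁ , t₂) ⟧
      ≡⟨ ⟦∨when∨when⟧ (const (a A.∧ b)) t₁ (varMeetConst i₁ a) t₂ (varMeetConst i₂ a) ⟩
    ⟦ const (a A.∧ b) ⟧ ∨ (opt t₁ ⟦ varMeetConst i₁ a ⟧ ∨ opt t₂ ⟦ varMeetConst i₂ a ⟧)
      ≡⟨ cong₂ _∨_ (trans (⟦const⟧ _) (trans (H.pres-∧ a b) (∧-comm (e a) (e b))))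
           (cong₂ _∨_ (cong (opt t₁) (⟦varMeetConst⟧ i₁ a)) (cong (opt t₂) (⟦varMeetConst⟧ i₂ a))) ⟩
    (e b ∧ e a) ∨ (opt t₁ (x₁ ∧ e a) ∨ opt t₂ (x₂ ∧ e a))
      ≡⟨ ⟦⟧∧ b t₁ t₂ (e a) ⟨
    ⟦ b , t₁ , t₂ ⟧ ∧ e a
      ≡⟨ ∧-comm _ _ ⟩
    e a ∧ ⟦ b , t₁ , t₂ ⟧ ∎
    where open ≡-Reasoning

  ⟦varMeet⟧ : ∀ i n → ⟦ varMeet i n ⟧ ≡ x i ∧ ⟦ n ⟧
  ⟦varMeet⟧ i (b , t₁ , t₂) = begin
    ⟦ varMeet i (b , t₁ , t₂) ⟧
      ≡⟨ ⟦∨when∨when⟧ (varMeetConst i b) t₁ (varMeetVar i i₁) t₂ (varMeetVar i i₂) ⟩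
    ⟦ varMeetConst i b ⟧ ∨ (opt t₁ ⟦ varMeetVar i i₁ ⟧ ∨ opt t₂ ⟦ varMeetVar i i₂ ⟧)
      ≡⟨ cong₂ _∨_ (trans (⟦varMeetConst⟧ i b) (∧-comm _ _))
           (cong₂ _∨_ (cong (opt t₁) (trans (⟦varMeetVar⟧ i i₁) (∧-comm _ _)))
                      (cong (opt t₂) (trans (⟦varMeetVar⟧ i i₂) (∧-comm _ _)))) ⟩
    (e b ∧ x i) ∨ (opt t₁ (x₁ ∧ x i) ∨ opt t₂ (x₂ ∧ x i))
      ≡⟨ ⟦⟧∧ b t₁ t₂ (x i) ⟨
    ⟦ b , t₁ , t₂ ⟧ ∧ x i
      ≡⟨ ∧-comm _ _ ⟩
    x i ∧ ⟦ b , t₁ , t₂ ⟧ ∎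
    where open ≡-Reasoning

  ⟦∧ᶠ⟧ : ∀ n n′ → ⟦ n ∧ᶠ n′ ⟧ ≡ ⟦ n ⟧ ∧ ⟦ n′ ⟧
  ⟦∧ᶠ⟧ (a , s₁ , s₂) n′ = begin
    ⟦ (a , s₁ , s₂) ∧ᶠ n′ ⟧
      ≡⟨ ⟦∨when∨when⟧ (constMeet a n′) s₁ (varMeet i₁ n′) s₂ (varMeet i₂ n′) ⟩
    ⟦ constMeet a n′ ⟧ ∨ (opt s₁ ⟦ varMeet i₁ n′ ⟧ ∨ opt s₂ ⟦ varMeet i₂ n′ ⟧)
      ≡⟨ cong₂ _∨_ (⟦constMeet⟧ a n′)
           (cong₂ _∨_ (cong (opt s₁) (⟦varMeet⟧ i₁ n′)) (cong (opt s₂) (⟦varMeet⟧ i₂ n′))) ⟩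
    (e a ∧ ⟦ n′ ⟧) ∨ (opt s₁ (x₁ ∧ ⟦ n′ ⟧) ∨ opt s₂ (x₂ ∧ ⟦ n′ ⟧))
      ≡⟨ ⟦⟧∧ a s₁ s₂ ⟦ n′ ⟧ ⟨
    ⟦ a , s₁ , s₂ ⟧ ∧ ⟦ n′ ⟧ ∎
    where open ≡-Reasoning

  ⟦minusConst⟧ : ∀ n b → ⟦ minusConst n b ⟧ ≡ ⟦ n ⟧ - e b
  ⟦minusConst⟧ (a , s₁ , s₂) b with g≤? b
  ... | yes g≤b = begin
    ⟦ const (a A.- b) ⟧                                      ≡⟨ ⟦const⟧ _ ⟩
    e (a A.- b)                                              ≡⟨ H.pres-- a b ⟩
    e a - e b                                                ≡⟨ ∨-identity _ ⟨
    (e a - e b) ∨ 𝟎                                          ≡⟨ cong (e a - e b ∨_) xs-e-b≡𝟎 ⟨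
    (e a - e b) ∨ (opt s₁ (x₁ - e b) ∨ opt s₂ (x₂ - e b))    ≡⟨ ⟦⟧- a s₁ s₂ (e b) ⟨
    ⟦ a , s₁ , s₂ ⟧ - e b                                    ∎
    where
      open ≡-Reasoning
      xs-e-b≡𝟎 : opt s₁ (x₁ - e b) ∨ opt s₂ (x₂ - e b) ≡ 𝟎
      xs-e-b≡𝟎 = trans (cong₂ _∨_ (trans (cong (opt s₁) (x-a≡𝟎 i₁ g≤b)) (opt-𝟎 s₁))
                                  (trans (cong (opt s₂) (x-a≡𝟎 i₂ g≤b)) (opt-𝟎 s₂)))
                       (∨-idem 𝟎)
  ... | no g≰b = begin
    e (a A.- b) ∨ (opt s₁ x₁ ∨ opt s₂ x₂)
      ≡⟨ cong₂ _∨_ (sym (H.pres-- a b)) (cong₂ _∨_ (cong (opt s₁) (x-a≡x i₁ g≰b))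
                                             (cong (opt s₂) (x-a≡x i₂ g≰b))) ⟨
    (e a - e b) ∨ (opt s₁ (x₁ - e b) ∨ opt s₂ (x₂ - e b))
      ≡⟨ ⟦⟧- a s₁ s₂ (e b) ⟨
    ⟦ a , s₁ , s₂ ⟧ - e b ∎
    where open ≡-Reasoning

  ⟦constMinusVar⟧ : ∀ i a → ⟦ constMinusVar i a ⟧ ≡ e a - x i
  ⟦constMinusVar⟧ i a with g≤? a
  ... | no g≰a = trans (⟦const⟧ _) (sym (a-x≡a-m i g≰a))
  ... | yes g≤a = from-shape shape
    where
      from-shape : PShape distinct →
        ⟦ if distinct then (a A.- g , flags (other i)) else const a ⟧ ≡ e a - x i
      from-shape (equal p q r) = trans (⟦const⟧ a) (sym (Equal.a-x≡a p q r i g≤a))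
      from-shape (complementary p q r) =
        trans (⟦flags⟧ _ (other i)) (sym (Complementary.a-x≡[a-g]∨x′ p q r i g≤a))

  ⟦varMinusVar⟧ : ∀ j i → ⟦ varMinusVar j i ⟧ ≡ x j - x i
  ⟦varMinusVar⟧ = from-shape shape
    where
      from-shape : PShape distinct → ∀ j i → ⟦ varMinusVar j i ⟧ ≡ x j - x i
      from-shape _ i₁ i₁ = trans ⟦𝟎ᶠ⟧ (sym (x-x≡𝟎 x₁))
      from-shape _ i₂ i₂ = trans ⟦𝟎ᶠ⟧ (sym (x-x≡𝟎 x₂))
      from-shape (equal x₁≡x₂ _ _) i₁ i₂ = trans ⟦𝟎ᶠ⟧ (sym (x≤y⇒x-y≡𝟎 (≤-reflexive x₁≡x₂)))
      from-shape (equal x₁≡x₂ _ _) i₂ i₁ = trans ⟦𝟎ᶠ⟧ (sym (x≤y⇒x-y≡𝟎 (≤-reflexive (sym x₁≡x₂))))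
      from-shape (complementary p q r) i₁ i₂ = trans (⟦var⟧ i₁) (sym (Complementary.x-x′≡x p q r i₁))
      from-shape (complementary p q r) i₂ i₁ = trans (⟦var⟧ i₂) (sym (Complementary.x-x′≡x p q r i₂))

  ⟦minusVar⟧ : ∀ i n → ⟦ minusVar i n ⟧ ≡ ⟦ n ⟧ - x i
  ⟦minusVar⟧ i (a , s₁ , s₂) = begin
    ⟦ minusVar i (a , s₁ , s₂) ⟧
      ≡⟨ ⟦∨when∨when⟧ (constMinusVar i a) s₁ (varMinusVar i₁ i) s₂ (varMinusVar i₂ i) ⟩
    ⟦ constMinusVar i a ⟧ ∨ (opt s₁ ⟦ varMinusVar i₁ i ⟧ ∨ opt s₂ ⟦ varMinusVar i₂ i ⟧)
      ≡⟨ cong₂ _∨_ (⟦constMinusVar⟧ i a)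
           (cong₂ _∨_ (cong (opt s₁) (⟦varMinusVar⟧ i₁ i)) (cong (opt s₂) (⟦varMinusVar⟧ i₂ i))) ⟩
    (e a - x i) ∨ (opt s₁ (x₁ - x i) ∨ opt s₂ (x₂ - x i))
      ≡⟨ ⟦⟧- a s₁ s₂ (x i) ⟨
    ⟦ a , s₁ , s₂ ⟧ - x i ∎
    where open ≡-Reasoning

  ⟦applyWhen⟧ : ∀ t (f : Form → Form) y → (∀ n → ⟦ f n ⟧ ≡ ⟦ n ⟧ - y) →
                ∀ n → ⟦ applyWhen t f n ⟧ ≡ ⟦ n ⟧ - opt t y
  ⟦applyWhen⟧ true f y ⟦f⟧ n = ⟦f⟧ n
  ⟦applyWhen⟧ false f y ⟦f⟧ n = sym (x-𝟎≡x ⟦ n ⟧)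

  ⟦-ᶠ⟧ : ∀ n n′ → ⟦ n -ᶠ n′ ⟧ ≡ ⟦ n ⟧ - ⟦ n′ ⟧
  ⟦-ᶠ⟧ n (b , t₁ , t₂) = begin
    ⟦ n -ᶠ (b , t₁ , t₂) ⟧
      ≡⟨ ⟦applyWhen⟧ t₂ (minusVar i₂) x₂ (⟦minusVar⟧ i₂) _ ⟩
    ⟦ applyWhen t₁ (minusVar i₁) (minusConst n b) ⟧ - opt t₂ x₂
      ≡⟨ cong (_- opt t₂ x₂) (⟦applyWhen⟧ t₁ (minusVar i₁) x₁ (⟦minusVar⟧ i₁) _) ⟩
    (⟦ minusConst n b ⟧ - opt t₁ x₁) - opt t₂ x₂
      ≡⟨ cong (λ y → (y - opt t₁ x₁) - opt t₂ x₂) (⟦minusConst⟧ n b) ⟩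
    ((⟦ n ⟧ - e b) - opt t₁ x₁) - opt t₂ x₂
      ≡⟨ x-[y∨z]≡x-y-z _ _ _ ⟨
    (⟦ n ⟧ - e b) - (opt t₁ x₁ ∨ opt t₂ x₂)
      ≡⟨ x-[y∨z]≡x-y-z _ _ _ ⟨
    ⟦ n ⟧ - ⟦ b , t₁ , t₂ ⟧ ∎
    where open ≡-Reasoning

  form : ∀ y → Σ Form (λ n → ⟦ n ⟧ ≡ y)
  form = generated Expressible closed (λ a → const a , ⟦const⟧ a) (var i₁ , ⟦var⟧ i₁) (var i₂ , ⟦var⟧ i₂)
    where
      Expressible : Carrier L → Set
      Expressible y = Σ Form (λ n → ⟦ n ⟧ ≡ y)
      closed : ClosedSub L₀ L e Expressible
      closed = (𝟎ᶠ , ⟦𝟎ᶠ⟧)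
             , (const A.𝟏 , trans (⟦const⟧ A.𝟏) H.pres-𝟏)
             , (λ _ _ (n , ⟦n⟧) (n′ , ⟦n′⟧) → n ∨ᶠ n′ , trans (⟦∨ᶠ⟧ n n′) (cong₂ _∨_ ⟦n⟧ ⟦n′⟧))
             , (λ _ _ (n , ⟦n⟧) (n′ , ⟦n′⟧) → n ∧ᶠ n′ , trans (⟦∧ᶠ⟧ n n′) (cong₂ _∧_ ⟦n⟧ ⟦n′⟧))
             , (λ _ _ (n , ⟦n⟧) (n′ , ⟦n′⟧) → n -ᶠ n′ , trans (⟦-ᶠ⟧ n n′) (cong₂ _-_ ⟦n⟧ ⟦n′⟧))

  ⟦flags⟧-absorbs-m : ∀ i a → ⟦ a A.∨ m i , flags i ⟧ ≡ e a ∨ x i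
  ⟦flags⟧-absorbs-m i a = begin
    ⟦ a A.∨ m i , flags i ⟧   ≡⟨ ⟦flags⟧ _ i ⟩
    e (a A.∨ m i) ∨ x i       ≡⟨ cong (_∨ x i) (H.pres-∨ a (m i)) ⟩
    (e a ∨ e (m i)) ∨ x i     ≡⟨ ∨-assoc _ _ _ ⟩
    e a ∨ (e (m i) ∨ x i)     ≡⟨ cong (e a ∨_) (≤⇒∨≡ (m≤x i)) ⟩
    e a ∨ x i                 ∎
    where open ≡-Reasoning

  ⟦canonical⟧ : ∀ n → ⟦ canonical n ⟧ ≡ ⟦ n ⟧
  ⟦canonical⟧ (a , s₁ , s₂) with g≤? a
  ... | yes g≤a = trans (⟦const⟧ a) (sym (trans (∨-comm _ _) (≤⇒∨≡ xs≤a)))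
    where
      opt≤a : ∀ s i → opt s (x i) ≤ e a
      opt≤a true i = ≤-trans (x≤g i) (H.mono-≤ g≤a)
      opt≤a false i = 𝟎-minimum (e a)
      xs≤a : opt s₁ x₁ ∨ opt s₂ x₂ ≤ e a
      xs≤a = ∨-least (opt≤a s₁ i₁) (opt≤a s₂ i₂)
  ... | no _ = from-shape shape s₁ s₂
    where
      from-shape : PShape distinct → ∀ s₁ s₂ → ⟦ reduce a s₁ s₂ ⟧ ≡ ⟦ a , s₁ , s₂ ⟧
      from-shape _ false false = refl
      from-shape _ true false = trans (⟦flags⟧-absorbs-m i₁ a) (sym (⟦flags⟧ a i₁))
      from-shape (equal x₁≡x₂ _ _) false true =
        trans (⟦flags⟧-absorbs-m i₁ a) (trans (cong (e a ∨_) x₁≡x₂) (sym (⟦flags⟧ a i₂)))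
      from-shape (complementary _ _ _) false true = trans (⟦flags⟧-absorbs-m i₂ a) (sym (⟦flags⟧ a i₂))
      from-shape (equal x₁≡x₂ _ _) true true =
        trans (⟦flags⟧-absorbs-m i₁ a) (cong (e a ∨_) (trans (sym (∨-idem x₁)) (cong (x₁ ∨_) x₁≡x₂)))
      from-shape (complementary p q r) true true =
        trans (⟦const⟧ _) (trans (H.pres-∨ a g) (cong (e a ∨_) (Complementary.g≡x₁∨x₂ p q r)))

  data Reduced : Form → Set where
    const-reduced : ∀ a → Reduced (const a)
    var₁-reduced : ∀ {a} → ¬ g A.≤ a → m₁ A.≤ a → Reduced (a , flags i₁)
    var₂-reduced : ∀ {a} → ¬ g A.≤ a → m₂ A.≤ a → distinct ≡ true → Reduced (a , flags i₂)

  canonical-reduced : ∀ n → Reduced (canonical n)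
  canonical-reduced (a , s₁ , s₂) with g≤? a
  ... | yes _ = const-reduced a
  ... | no g≰a = from-shape shape s₁ s₂
    where
      reduced₁ : Reduced (a A.∨ m₁ , flags i₁)
      reduced₁ = var₁-reduced (g≰a∨m i₁ g≰a) (A.y≤x∨y a m₁)
      from-shape : PShape distinct → ∀ s₁ s₂ → Reduced (reduce a s₁ s₂)
      from-shape _ false false = const-reduced a
      from-shape _ true false = reduced₁
      from-shape (equal _ _ _) false true = reduced₁
      from-shape (complementary _ _ _) false true =
        var₂-reduced (g≰a∨m i₂ g≰a) (A.y≤x∨y a m₂) refl
      from-shape (equal _ _ _) true true = reduced₁
      from-shape (complementary _ _ _) true true = const-reduced (a A.∨ g)

  a≢b∨x : ∀ i {a b} → ¬ g A.≤ b → e a ≢ e b ∨ x i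
  a≢b∨x i {a} {b} g≰b a≡b∨x = x∉L₀ i (a A.- b , (begin
    e (a A.- b)                ≡⟨ H.pres-- a b ⟩
    e a - e b                  ≡⟨ cong (_- e b) a≡b∨x ⟩
    (e b ∨ x i) - e b          ≡⟨ -‿distribʳ-∨ _ _ _ ⟩
    (e b - e b) ∨ (x i - e b)  ≡⟨ cong₂ _∨_ (x-x≡𝟎 (e b)) (x-a≡x i g≰b) ⟩
    𝟎 ∨ x i                    ≡⟨ ∨-identityˡ _ ⟩
    x i                        ∎))
    where open ≡-Reasoning

  a∨x≡b∨x⇒a≤b : ∀ i {a b} → m i A.≤ b → e a ∨ x i ≡ e b ∨ x i → a A.≤ b
  a∨x≡b∨x⇒a≤b i {a} {b} m≤b a∨x≡b∨x =
    A.≤-trans (A.-‿covers a b) (A.∨-least A.≤-refl (A.≤-trans a-b≤m m≤b))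
    where
      a-b≤m : a A.- b A.≤ m i
      a-b≤m = ≤x⇒≤m i (subst (_≤ x i) (sym (H.pres-- a b))
        (x-y≤z (subst (e a ≤_) a∨x≡b∨x (x≤x∨y (e a) (x i)))))

  a∨x≡b∨x⇒a≡b : ∀ i {a b} → m i A.≤ a → m i A.≤ b → e a ∨ x i ≡ e b ∨ x i → a ≡ b
  a∨x≡b∨x⇒a≡b i m≤a m≤b eq = A.≤-antisym (a∨x≡b∨x⇒a≤b i m≤b eq) (a∨x≡b∨x⇒a≤b i m≤a (sym eq))

  a∨x₁≢b∨x₂ : PShape true → ∀ {a b} → ¬ g A.≤ b → e a ∨ x₁ ≢ e b ∨ x₂
  a∨x₁≢b∨x₂ (complementary p q r) {a} {b} g≰b a∨x₁≡b∨x₂ =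
    x∉L₀ i₁ (m₁ , ≤-antisym (m≤x i₁) (subst (_≤ e m₁) x₁≤b (x∧a≤m i₁ g≰b)))
    where
      open Complementary p q r
      x₁≤b : x₁ ≤ e b
      x₁≤b = subst (_≤ e b) (x-x′≡x i₁)
        (x-y≤z (subst (x₁ ≤_) (trans a∨x₁≡b∨x₂ (∨-comm (e b) x₂)) (y≤x∨y (e a) x₁)))

  reduced-injective : ∀ {n n′} → Reduced n → Reduced n′ → ⟦ n ⟧ ≡ ⟦ n′ ⟧ → n ≡ n′
  reduced-injective (const-reduced a) (const-reduced b) eq =
    cong const (e-inj (trans (sym (⟦const⟧ a)) (trans eq (⟦const⟧ b))))
  reduced-injective (const-reduced a) (var₁-reduced {b} g≰b _) eq =
    ⊥-elim (a≢b∨x i₁ g≰b (trans (sym (⟦const⟧ a)) (trans eq (⟦flags⟧ b i₁))))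
  reduced-injective (const-reduced a) (var₂-reduced {b} g≰b _ _) eq =
    ⊥-elim (a≢b∨x i₂ g≰b (trans (sym (⟦const⟧ a)) (trans eq (⟦flags⟧ b i₂))))
  reduced-injective (var₁-reduced {a} g≰a _) (const-reduced b) eq =
    ⊥-elim (a≢b∨x i₁ g≰a (trans (sym (⟦const⟧ b)) (trans (sym eq) (⟦flags⟧ a i₁))))
  reduced-injective (var₂-reduced {a} g≰a _ _) (const-reduced b) eq =
    ⊥-elim (a≢b∨x i₂ g≰a (trans (sym (⟦const⟧ b)) (trans (sym eq) (⟦flags⟧ a i₂))))
  reduced-injective (var₁-reduced {a} _ m≤a) (var₁-reduced {b} _ m≤b) eq =
    cong (_, flags i₁) (a∨x≡b∨x⇒a≡b i₁ m≤a m≤b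
      (trans (sym (⟦flags⟧ a i₁)) (trans eq (⟦flags⟧ b i₁))))
  reduced-injective (var₂-reduced {a} _ m≤a _) (var₂-reduced {b} _ m≤b _) eq =
    cong (_, flags i₂) (a∨x≡b∨x⇒a≡b i₂ m≤a m≤b
      (trans (sym (⟦flags⟧ a i₂)) (trans eq (⟦flags⟧ b i₂))))
  reduced-injective (var₁-reduced {a} _ _) (var₂-reduced {b} g≰b _ refl) eq =
    ⊥-elim (a∨x₁≢b∨x₂ shape g≰b (trans (sym (⟦flags⟧ a i₁)) (trans eq (⟦flags⟧ b i₂))))
  reduced-injective (var₂-reduced {a} g≰a _ refl) (var₁-reduced {b} _ _) eq =
    ⊥-elim (a∨x₁≢b∨x₂ shape g≰a (trans (sym (⟦flags⟧ b i₁)) (trans (sym eq) (⟦flags⟧ a i₂))))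

  canonical-≡ : ∀ n n′ → ⟦ n ⟧ ≡ ⟦ n′ ⟧ → canonical n ≡ canonical n′
  canonical-≡ n n′ eq = reduced-injective (canonical-reduced n) (canonical-reduced n′)
    (trans (⟦canonical⟧ n) (trans eq (sym (⟦canonical⟧ n′))))

-- Algebras with the same presentation are isomorphic

module Isomorphism
  (L₀ L₁ L₂ : CoHeyting) {e₁ : Carrier L₀ → Carrier L₁} {e₂ : Carrier L₀ → Carrier L₂}
  (e₁-hom : IsHom L₀ L₁ e₁) (e₁-inj : Injective _≡_ _≡_ e₁)
  (e₂-hom : IsHom L₀ L₂ e₂) (e₂-inj : Injective _≡_ _≡_ e₂)
  {g g⁻ : Carrier L₀} (g-prime : CoHeytingProperties.JoinPrime L₀ g)
  (g⁻-def : CoHeyting.IsMinusOf L₀ g g⁻) (g≤? : Decidable (CoHeyting._≤_ L₀ g))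
  {m₁ m₂ : Carrier L₀} {distinct : Bool}
  (P₁ : Presentation L₀ L₁ e₁ g g⁻ m₁ m₂ distinct)
  (P₂ : Presentation L₀ L₂ e₂ g g⁻ m₁ m₂ distinct)
  where

  private
    module L₁ = CoHeyting L₁
    module L₂ = CoHeyting L₂
    module R₁ = Realisation L₀ L₁ e₁-hom e₁-inj g-prime g⁻-def g≤? P₁
    module R₂ = Realisation L₀ L₂ e₂-hom e₂-inj g-prime g⁻-def g≤? P₂
  open NormalForm L₀ g m₁ m₂ distinct g≤?

  ⟦⟧₁≡⇒⟦⟧₂≡ : ∀ n n′ → R₁.⟦ n ⟧ ≡ R₁.⟦ n′ ⟧ → R₂.⟦ n ⟧ ≡ R₂.⟦ n′ ⟧
  ⟦⟧₁≡⇒⟦⟧₂≡ n n′ eq = begin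
    R₂.⟦ n ⟧              ≡⟨ R₂.⟦canonical⟧ n ⟨
    R₂.⟦ canonical n ⟧    ≡⟨ cong R₂.⟦_⟧ (R₁.canonical-≡ n n′ eq) ⟩
    R₂.⟦ canonical n′ ⟧   ≡⟨ R₂.⟦canonical⟧ n′ ⟩
    R₂.⟦ n′ ⟧             ∎
    where open ≡-Reasoning

  ⟦⟧₂≡⇒⟦⟧₁≡ : ∀ n n′ → R₂.⟦ n ⟧ ≡ R₂.⟦ n′ ⟧ → R₁.⟦ n ⟧ ≡ R₁.⟦ n′ ⟧
  ⟦⟧₂≡⇒⟦⟧₁≡ n n′ eq = begin
    R₁.⟦ n ⟧              ≡⟨ R₁.⟦canonical⟧ n ⟨
    R₁.⟦ canonical n ⟧    ≡⟨ cong R₁.⟦_⟧ (R₂.canonical-≡ n n′ eq) ⟩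
    R₁.⟦ canonical n′ ⟧   ≡⟨ R₁.⟦canonical⟧ n′ ⟩
    R₁.⟦ n′ ⟧             ∎
    where open ≡-Reasoning

  φ : Carrier L₁ → Carrier L₂
  φ y = R₂.⟦ proj₁ (R₁.form y) ⟧

  φ-⟦⟧ : ∀ n → φ R₁.⟦ n ⟧ ≡ R₂.⟦ n ⟧
  φ-⟦⟧ n = ⟦⟧₁≡⇒⟦⟧₂≡ (proj₁ (R₁.form R₁.⟦ n ⟧)) n (proj₂ (R₁.form R₁.⟦ n ⟧))

  φ-pres : (_∙₁_ : Carrier L₁ → Carrier L₁ → Carrier L₁) (_∙₂_ : Carrier L₂ → Carrier L₂ → Carrier L₂)
           (_∙ᶠ_ : Form → Form → Form) →
           (∀ n n′ → R₁.⟦ n ∙ᶠ n′ ⟧ ≡ R₁.⟦ n ⟧ ∙₁ R₁.⟦ n′ ⟧) →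
           (∀ n n′ → R₂.⟦ n ∙ᶠ n′ ⟧ ≡ R₂.⟦ n ⟧ ∙₂ R₂.⟦ n′ ⟧) →
           ∀ y z → φ (y ∙₁ z) ≡ φ y ∙₂ φ z
  φ-pres _∙₁_ _∙₂_ _∙ᶠ_ sound₁ sound₂ y z = begin
    φ (y ∙₁ z)                    ≡⟨ cong φ (cong₂ _∙₁_ (proj₂ (R₁.form y)) (proj₂ (R₁.form z))) ⟨
    φ (R₁.⟦ n ⟧ ∙₁ R₁.⟦ n′ ⟧)     ≡⟨ cong φ (sound₁ n n′) ⟨
    φ R₁.⟦ n ∙ᶠ n′ ⟧              ≡⟨ φ-⟦⟧ (n ∙ᶠ n′) ⟩
    R₂.⟦ n ∙ᶠ n′ ⟧                ≡⟨ sound₂ n n′ ⟩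
    R₂.⟦ n ⟧ ∙₂ R₂.⟦ n′ ⟧         ∎
    where
      open ≡-Reasoning
      n = proj₁ (R₁.form y)
      n′ = proj₁ (R₁.form z)

  φ-hom : IsHom L₁ L₂ φ
  φ-hom = record
    { pres-𝟎 = trans (cong φ (sym R₁.⟦𝟎ᶠ⟧)) (trans (φ-⟦⟧ 𝟎ᶠ) R₂.⟦𝟎ᶠ⟧)
    ; pres-𝟏 = trans (cong φ (sym (trans (R₁.⟦const⟧ _) H₁.pres-𝟏)))
                 (trans (φ-⟦⟧ (const _)) (trans (R₂.⟦const⟧ _) H₂.pres-𝟏))
    ; pres-∨ = φ-pres L₁._∨_ L₂._∨_ _∨ᶠ_ R₁.⟦∨ᶠ⟧ R₂.⟦∨ᶠ⟧
    ; pres-∧ = φ-pres L₁._∧_ L₂._∧_ _∧ᶠ_ R₁.⟦∧ᶠ⟧ R₂.⟦∧ᶠ⟧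
    ; pres-- = φ-pres L₁._-_ L₂._-_ _-ᶠ_ R₁.⟦-ᶠ⟧ R₂.⟦-ᶠ⟧
    }
    where
      module H₁ = IsHom e₁-hom
      module H₂ = IsHom e₂-hom

  φ-injective : Injective _≡_ _≡_ φ
  φ-injective {y} {z} φy≡φz = begin
    y                          ≡⟨ proj₂ (R₁.form y) ⟨
    R₁.⟦ proj₁ (R₁.form y) ⟧   ≡⟨ ⟦⟧₂≡⇒⟦⟧₁≡ (proj₁ (R₁.form y)) (proj₁ (R₁.form z)) φy≡φz ⟩
    R₁.⟦ proj₁ (R₁.form z) ⟧   ≡⟨ proj₂ (R₁.form z) ⟩
    z                          ∎
    where open ≡-Reasoning

  φ-surjective : Surjective _≡_ _≡_ φ
  φ-surjective w = R₁.⟦ n ⟧ , λ { refl → trans (φ-⟦⟧ n) (proj₂ (R₂.form w)) }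
    where n = proj₁ (R₂.form w)

  φ-fixes-L₀ : ∀ a → φ (e₁ a) ≡ e₂ a
  φ-fixes-L₀ a = trans (cong φ (sym (R₁.⟦const⟧ a))) (trans (φ-⟦⟧ (const a)) (R₂.⟦const⟧ a))

  iso : ∃[ φ ] (IsIso L₁ L₂ φ × (∀ a → φ (e₁ a) ≡ e₂ a))
  iso = φ , (φ-hom , φ-injective , φ-surjective) , φ-fixes-L₀

-- Presentations from primitive tuples and their signatures

card : Bool → ℕ
card false = 1
card true = 2

card-injective : ∀ {d d′} → card d ≡ card d′ → d ≡ d′
card-injective {false} {false} _ = refl
card-injective {true} {true} _ = refl

pair-≡ : ∀ {A : Set} {S : A → Set} {p q p′ q′ : A} →
         (∀ a → S a ⇔ (a ≡ p ⊎ a ≡ q)) → (∀ a → S a ⇔ (a ≡ p′ ⊎ a ≡ q′)) →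
         (p ≡ p′ × q ≡ q′) ⊎ (p ≡ q′ × q ≡ p′)
pair-≡ {p = p} {q} {p′} {q′} S≡pq S≡p′q′ = decide (pq⇒p′q′ (inj₁ refl)) (pq⇒p′q′ (inj₂ refl))
  where
    pq⇒p′q′ : ∀ {a} → a ≡ p ⊎ a ≡ q → a ≡ p′ ⊎ a ≡ q′
    pq⇒p′q′ {a} = Equivalence.to (S≡p′q′ a) ∘ Equivalence.from (S≡pq a)
    p′q′⇒pq : ∀ {a} → a ≡ p′ ⊎ a ≡ q′ → a ≡ p ⊎ a ≡ q
    p′q′⇒pq {a} = Equivalence.to (S≡pq a) ∘ Equivalence.from (S≡p′q′ a)
    decide : p ≡ p′ ⊎ p ≡ q′ → q ≡ p′ ⊎ q ≡ q′ → (p ≡ p′ × q ≡ q′) ⊎ (p ≡ q′ × q ≡ p′)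
    decide (inj₁ p≡p′) (inj₂ q≡q′) = inj₁ (p≡p′ , q≡q′)
    decide (inj₂ p≡q′) (inj₁ q≡p′) = inj₂ (p≡q′ , q≡p′)
    decide (inj₁ p≡p′) (inj₁ q≡p′) = inj₁ (p≡p′ , [ q≡q′ , sym ] (p′q′⇒pq (inj₂ refl)))
      where
        q≡q′ : q′ ≡ p → q ≡ q′
        q≡q′ q′≡p = trans q≡p′ (trans (sym p≡p′) (sym q′≡p))
    decide (inj₂ p≡q′) (inj₂ q≡q′) = inj₁ ([ sym , p≡p′ ] (p′q′⇒pq (inj₁ refl)) , q≡q′)
      where
        p≡p′ : p′ ≡ q → p ≡ p′
        p≡p′ p′≡q = trans p≡q′ (trans (sym q≡q′) (sym p′≡q))

record PrimitivePresentation (L₀ L : CoHeyting) (e : Carrier L₀ → Carrier L)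
                             (g : Carrier L₀) (S : Carrier L₀ → Set) (k : ℕ) : Set₁ where
  constructor presented
  field
    g-irreducible : CoHeyting.JoinIrreducible L₀ g
    g⁻ m₁ m₂ : Carrier L₀
    distinct : Bool
    g⁻-def : CoHeyting.IsMinusOf L₀ g g⁻
    presentation : Presentation L₀ L e g g⁻ m₁ m₂ distinct
    S-def : ∀ a → S a ⇔ (a ≡ m₁ ⊎ a ≡ m₂)
    k-def : k ≡ card distinct

module _ {L₀ L : CoHeyting} {e : Carrier L₀ → Carrier L}
         (e-hom : IsHom L₀ L e) (e-inj : Injective _≡_ _≡_ e)
         (_≟₀_ : DecidableEquality (Carrier L₀)) where
  private
    module A = CoHeytingProperties L₀
    module H = HomProperties e-hom
  open CoHeytingProperties L

  IsGOf-unique : ∀ {x g g′} → IsGOf L₀ L e x g → IsGOf L₀ L e x g′ → g ≡ g′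
  IsGOf-unique (g-lb , g-glb) (g′-lb , g′-glb) = A.≤-antisym (g′-glb _ g-lb) (g-glb _ g′-lb)

  -- If x ≤ e a with h ≰ a, then x ≤ e (h ∧ a) ≤ e h⁻, so x = h⁻ ∧ x would lie in L₀.
  IsGOf-generator : ∀ {x h h⁻ m} → A.IsMinusOf h h⁻ → e m ≡ e h⁻ ∧ x →
                    ¬ InSub L₀ L e x → x ≤ e h → IsGOf L₀ L e x h
  IsGOf-generator {x} {h} {h⁻} {m} h⁻-def m-def x∉L₀ x≤h = h≤ , λ c c≤ → c≤ h x≤h
    where
      h≤ : ∀ a → x ≤ e a → h A.≤ a
      h≤ a x≤a with A.≤-decidable _≟₀_ h a
      ... | yes h≤a = h≤a
      ... | no h≰a = ⊥-elim (x∉L₀ (m , ≤-antisym (subst (_≤ x) (sym m-def) (x∧y≤y _ _))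
        (subst (x ≤_) (sym m-def) (∧-greatest (≤-trans (∧-greatest x≤h x≤a) h∧a≤h⁻) ≤-refl))))
        where
          h∧a≤h⁻ : e h ∧ e a ≤ e h⁻
          h∧a≤h⁻ = subst (_≤ e h⁻) (H.pres-∧ h a) (H.mono-≤ (A.≱⇒∧≤minus h⁻-def h≰a))

  Alternative : Carrier L₀ → Carrier L₀ → Carrier L → Carrier L → Set
  Alternative g g⁻ x₁ x₂ =
      (x₁ ≡ x₂ × (e g⁻ ∧ x₁) ≪ x₁ × x₁ ≪ e g)
    ⊎ (x₁ ≢ x₂ × InSub L₀ L e (x₁ ∧ x₂) × e g - x₁ ≡ x₂ × e g - x₂ ≡ x₁)

  alternative⇒shape : ∀ {g g⁻ x₁ x₂ k} → Alternative g g⁻ x₁ x₂ →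
                      (x₁ ≡ x₂ → k ≡ 1) → (x₁ ≢ x₂ → k ≡ 2) →
                      ∃[ d ] (Shape L₀ L e g g⁻ x₁ x₂ d × k ≡ card d)
  alternative⇒shape (inj₁ (x₁≡x₂ , m≪x , x≪g)) k≡1 _ = false , equal x₁≡x₂ m≪x x≪g , k≡1 x₁≡x₂
  alternative⇒shape (inj₂ (x₁≢x₂ , x₁∧x₂∈L₀ , g-x₁≡x₂ , g-x₂≡x₁)) _ k≡2 =
    true , complementary x₁∧x₂∈L₀ g-x₁≡x₂ g-x₂≡x₁ , k≡2 x₁≢x₂

  primitive-presentation : ∀ {x₁ x₂ g S k} → Primitive L₀ L e x₁ x₂ → GeneratedBy L₀ L e x₁ x₂ →
                           HasSignature L₀ L e x₁ x₂ g S k → PrimitivePresentation L₀ L e g S k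
  primitive-presentation {S = S}
    (x₁∉L₀ , x₂∉L₀ , h , h⁻ , h-irr , h⁻-def , (m₁ , m₁-def) , (m₂ , m₂-def) , alt) gen
    (g-def , (s⁻ , s⁻-def , S-def) , k₁ , k₂)
    with alternative⇒shape alt k₁ k₂
  ... | d , sh , k≡card
    with IsGOf-unique (IsGOf-generator h⁻-def m₁-def x₁∉L₀ (proj₁ (shape-≤ sh))) g-def
  ... | refl with A.IsMinusOf-unique s⁻-def h⁻-def
  ... | refl = presented h-irr h⁻ m₁ m₂ d h⁻-def P S-char k≡card
    where
      P : Presentation L₀ L e h h⁻ m₁ m₂ d
      P = record { x₁∉L₀ = x₁∉L₀ ; x₂∉L₀ = x₂∉L₀ ; m₁-def = m₁-def ; m₂-def = m₂-def
                 ; shape = sh ; generated = gen }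
      S-char : ∀ a → S a ⇔ (a ≡ m₁ ⊎ a ≡ m₂)
      S-char a = mk⇔ (⊎-map (to-m m₁-def) (to-m m₂-def) ∘ Equivalence.to (S-def a))
                     (Equivalence.from (S-def a) ∘ ⊎-map (from-m m₁-def) (from-m m₂-def))
        where
          to-m : ∀ {m y} → e m ≡ y → e a ≡ y → a ≡ m
          to-m m-def ea≡y = e-inj (trans ea≡y (sym m-def))
          from-m : ∀ {m y} → e m ≡ y → a ≡ m → e a ≡ y
          from-m m-def refl = m-def

same-signature⇒isomorphic :
  ∀ {L₀ L₁ L₂ : CoHeyting} {e₁ : Carrier L₀ → Carrier L₁} {e₂ : Carrier L₀ → Carrier L₂} {g S k} →
  DecidableEquality (Carrier L₀) →
  IsHom L₀ L₁ e₁ → Injective _≡_ _≡_ e₁ → IsHom L₀ L₂ e₂ → Injective _≡_ _≡_ e₂ →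
  PrimitivePresentation L₀ L₁ e₁ g S k → PrimitivePresentation L₀ L₂ e₂ g S k →
  ∃[ φ ] (IsIso L₁ L₂ φ × (∀ a → φ (e₁ a) ≡ e₂ a))
same-signature⇒isomorphic {L₀} {L₁} {L₂} _≟₀_ e₁-hom e₁-inj e₂-hom e₂-inj
  (presented g-irr g⁻ _ _ _ g⁻-def P₁ S₁ k₁) (presented _ _ _ _ _ g⁻′-def P₂ S₂ k₂)
  with CoHeytingProperties.IsMinusOf-unique L₀ g⁻′-def g⁻-def | card-injective (trans (sym k₂) k₁)
... | refl | refl =
  Isomorphism.iso L₀ L₁ L₂ e₁-hom e₁-inj e₂-hom e₂-inj
    (CoHeytingProperties.join-irreducible⇒prime L₀ _≟₀_ g-irr) g⁻-def
    (CoHeytingProperties.≤-decidable L₀ _≟₀_ _) P₁ (align P₂ (pair-≡ S₁ S₂))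

corollary3p5 :
    (L₀ L₁ L₂ : CoHeyting) →
    Finite (Carrier L₁) → Finite (Carrier L₂) →
    (e₁ : Carrier L₀ → Carrier L₁) → IsEmbedding L₀ L₁ e₁ →
    (e₂ : Carrier L₀ → Carrier L₂) → IsEmbedding L₀ L₂ e₂ →
    (x₁₁ x₁₂ : Carrier L₁) → Primitive L₀ L₁ e₁ x₁₁ x₁₂ →
      GeneratedBy L₀ L₁ e₁ x₁₁ x₁₂ →
    (x₂₁ x₂₂ : Carrier L₂) → Primitive L₀ L₂ e₂ x₂₁ x₂₂ →
      GeneratedBy L₀ L₂ e₂ x₂₁ x₂₂ →
    (∃[ g ] ∃[ S ] ∃[ k ] (HasSignature L₀ L₁ e₁ x₁₁ x₁₂ g S k
                         × HasSignature L₀ L₂ e₂ x₂₁ x₂₂ g S k)) →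
    ∃[ φ ] (IsIso L₁ L₂ φ × (∀ a → φ (e₁ a) ≡ e₂ a))
corollary3p5 L₀ L₁ L₂ fin₁ _ e₁ (e₁-hom , e₁-inj) e₂ (e₂-hom , e₂-inj)
  _ _ prim₁ gen₁ _ _ prim₂ gen₂ (_ , _ , _ , sig₁ , sig₂) =
  same-signature⇒isomorphic _≟₀_ e₁-hom e₁-inj e₂-hom e₂-inj
    (primitive-presentation e₁-hom e₁-inj _≟₀_ prim₁ gen₁ sig₁)
    (primitive-presentation e₂-hom e₂-inj _≟₀_ prim₂ gen₂ sig₂)
  where
    -- The finiteness of L₁ alone makes L₀ discrete, hence its order decidable.
    _≟₀_ : DecidableEquality (Carrier L₀)
    _≟₀_ = via-injection (mk↣ e₁-inj) (finite⇒≟ fin₁)
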